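{- (1) For all integers $k\ge 0$ and $n\ge 1$, $p^1_{n,n+k;\le n+k}=p_{n-1,n+k;\le n+k}$. (2) For all integers $k\ge 1$ and $n\ge 1$, $$p^1_{n,n+k;\le n+k}=\sum_{i=1}^{n}\binom{n-1}{i-1}\,p^1_{i,i+k-1;\le i+k-1}\,p_{n-i}.$$
   Context: Parking model: there are $m$ parking spaces in a line, numbered $1,\dots,m$. A preference set of length $n$ is a sequence $(a_1,\dots,a_n)$ of integers with $1\le a_i\le m$; cars $1,\dots,n$ arrive in order, car $i$ parks in the first unoccupied space numbered $\ge a_i$ if one exists, otherwise it fails to park. A $k$-flaw preference set is one where exactly $k$ cars fail to park; a $0$-flaw preference set is a parking function. $p_{n,m;\le s;k}$ is the number of $k$-flaw preference sets of length $n$ with $m$ spaces and all $a_i\le s$, and $p^l_{n,m;\le s;k}$ the number of those with $a_1=l$. Omitted $k$ means $k=0$; $p_j$ (no $m$, no $s$) denotes the number of parking functions of length $j$ with $j$ spaces, i.e. $p_j=(j+1)^{j-1}$, with $p_0=1$. For length $0$ the unique (empty) sequence counts as a parking function, so counts of parking functions of length $0$ equal $1$. -}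

module Defs where

open import Data.Nat using (ℕ; zero; suc; _≟_)
open import Data.Bool using (Bool; true; false)
open import Data.Maybe using (Maybe; just; nothing)
import Data.Maybe as Maybe
open import Data.List using (List; []; _∷_; [_]; map; concatMap; upTo; replicate; filterᵇ; length)
open import Relation.Nullary.Decidable using (does)

-- Occupancy of the m spaces (space 1 first); true = occupied.
-- park occ a : car with preference a parks in the first unoccupied space with
-- number ≥ a; nothing if there is none.
park : List Bool → ℕ → Maybe (List Bool)
park []           _             = nothing
park (b ∷ bs)     (suc (suc a)) = Maybe.map (b ∷_) (park bs (suc a))
park (true ∷ bs)  _             = Maybe.map (true ∷_) (park bs 1)
park (false ∷ bs) _             = just (true ∷ bs)

flawsFrom : List Bool → List ℕ → ℕ
flawsFrom occ [] = 0
flawsFrom occ (a ∷ as) with park occ a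
... | nothing   = suc (flawsFrom occ as)
... | just occ' = flawsFrom occ' as

flaws : ℕ → List ℕ → ℕ
flaws m as = flawsFrom (replicate m false) as

prefs : ℕ → ℕ → List (List ℕ)
prefs zero    s = [ [] ]
prefs (suc n) s = concatMap (λ a → map (a ∷_) (prefs n s)) (map suc (upTo s))

-- p_{n,m;≤s;k}: k-flaw preference sets of length n, m spaces, all a_i ≤ s
-- (entries also ≥ 1; callers use s ≤ m so entries are ≤ m)
pCount : (n m s k : ℕ) → ℕ
pCount n m s k = length (filterᵇ (λ as → does (flaws m as ≟ k)) (prefs n s))

headIs : ℕ → List ℕ → Bool
headIs l []       = false
headIs l (a ∷ _)  = does (a ≟ l)

-- p^l_{n,m;≤s;k}: those with a_1 = l
pCountFirst : (l n m s k : ℕ) → ℕ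
pCountFirst l n m s k =
  length (filterᵇ (λ as → Data.Bool._∧_ (headIs l as) (does (flaws m as ≟ k))) (prefs n s))

pf : ℕ → ℕ
pf j = pCount j j j 0

-- A car preferring space 1 simply fills the first free space.  If B is A with
-- its first free space filled, then running the same preferences from A and from
-- B keeps the two occupancies so related until B is full; so when B has at least
-- as many free spaces as there are cars, the same sequences park from both.  This
-- gives (1).  For (2), let N = n - 1 cars park in an empty lot of m = n + k
-- spaces, and classify the sequences by the last space e left free.  The cars
-- split into those parking before e and the m - 1 - e cars filling every space
-- after e; the two groups are interleaved in C(N, m - 1 - e) ways, and the second
-- one forms a parking function.  The binomial vanishes for e < k, and e = k + j
-- contributes C(N, j) p^1_{j+1,j+k} p_{N-j}, the middle factor by (1).
module Submission where

open import Defs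
open import Algebra.Properties.CommutativeSemigroup using (interchange)
open import Data.Bool using (Bool; true; false; if_then_else_; not; _∧_)
open import Data.List
  using (List; []; _∷_; _++_; map; applyUpTo; upTo; concatMap; filterᵇ; length; replicate)
open import Data.List.Properties using (map-applyUpTo; length-replicate; length-++; filter-++)
  renaming (map-∘ to List-map-∘)
open import Data.Maybe using (Maybe; just; nothing; maybe′)
import Data.Maybe as Maybe
open import Data.Maybe.Properties using (map-∘)
open import Data.Nat
  using (ℕ; zero; suc; _+_; _*_; _∸_; _≤_; _<_; z≤n; s≤s; z<s; s<s; _≟_; _≤?_; _≡ᵇ_;
         _≤′_; ≤′-refl; ≤′-step)
open import Data.Nat.Combinatorics using (_C_; k>n⇒nCk≡0; nCk+nC[k+1]≡[n+1]C[k+1]; nCk≡nC[n∸k])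
open import Data.Nat.ListAction using (sum)
open import Data.Nat.Properties
  using (+-comm; +-assoc; +-identityʳ; *-comm; *-zeroʳ; *-distribˡ-+; *-distribʳ-+;
         +-∸-assoc; m∸[m∸n]≡n; [m+n]∸[m+o]≡n∸o; +-commutativeSemigroup;
         ≤-pred; ≤-trans; ≤-refl; <⇒≤; ≰⇒>; ≤⇒≤′; ≤′⇒≤; m≤n⇒m≤1+n; m≤m+n; m<m+n;
         m<n⇒0<n∸m; +-monoˡ-≤; m≤n⇒∃[o]m+o≡n; suc-injective)
open import Data.Product using (_×_; _,_)
open import Function using (_∘_; id)
open import Relation.Binary.PropositionalEquality
  using (_≡_; refl; sym; trans; cong; cong₂; subst; module ≡-Reasoning)
open import Relation.Nullary using (yes; no)
open import Relation.Nullary.Decidable using (does; T?)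

-- Finite sums

∑< : ℕ → (ℕ → ℕ) → ℕ
∑< n f = sum (applyUpTo f n)

syntax ∑< n (λ i → e) = ∑[ i < n ] e

sum-map-upTo : ∀ n (f : ℕ → ℕ) → sum (map f (upTo n)) ≡ ∑< n f
sum-map-upTo n f = cong sum (map-applyUpTo id f n)

∑-cong< : ∀ n {f g : ℕ → ℕ} → (∀ i → i < n → f i ≡ g i) → ∑< n f ≡ ∑< n g
∑-cong< zero    eq = refl
∑-cong< (suc n) eq = cong₂ _+_ (eq 0 z<s) (∑-cong< n (λ i i<n → eq (suc i) (s<s i<n)))

∑-cong : ∀ n {f g : ℕ → ℕ} → (∀ i → f i ≡ g i) → ∑< n f ≡ ∑< n g
∑-cong n eq = ∑-cong< n (λ i _ → eq i)

∑-zero : ∀ n {f : ℕ → ℕ} → (∀ i → i < n → f i ≡ 0) → ∑< n f ≡ 0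
∑-zero zero    eq = refl
∑-zero (suc n) eq = cong₂ _+_ (eq 0 z<s) (∑-zero n (λ i i<n → eq (suc i) (s<s i<n)))

∑-distrib-+ : ∀ n (f g : ℕ → ℕ) → ∑[ i < n ] (f i + g i) ≡ ∑< n f + ∑< n g
∑-distrib-+ zero    f g = refl
∑-distrib-+ (suc n) f g =
  trans (cong (f 0 + g 0 +_) (∑-distrib-+ n (f ∘ suc) (g ∘ suc)))
        (interchange +-commutativeSemigroup (f 0) (g 0) _ _)

*-distribˡ-∑ : ∀ n c (f : ℕ → ℕ) → c * ∑< n f ≡ ∑[ i < n ] (c * f i)
*-distribˡ-∑ zero    c f = *-zeroʳ c
*-distribˡ-∑ (suc n) c f =
  trans (*-distribˡ-+ c (f 0) _) (cong (c * f 0 +_) (*-distribˡ-∑ n c (f ∘ suc)))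

*-distribʳ-∑ : ∀ n c (f : ℕ → ℕ) → ∑< n f * c ≡ ∑[ i < n ] (f i * c)
*-distribʳ-∑ n c f =
  trans (*-comm _ c) (trans (*-distribˡ-∑ n c f) (∑-cong n (λ i → *-comm c (f i))))

∑-comm : ∀ m n (F : ℕ → ℕ → ℕ) → ∑[ i < m ] ∑[ j < n ] F i j ≡ ∑[ j < n ] ∑[ i < m ] F i j
∑-comm zero    n F = sym (∑-zero n (λ _ _ → refl))
∑-comm (suc m) n F =
  trans (cong (∑[ j < n ] F 0 j +_) (∑-comm m n (F ∘ suc)))
        (sym (∑-distrib-+ n (F 0) (λ j → ∑[ i < m ] F (suc i) j)))

∑-split : ∀ m n (f : ℕ → ℕ) → ∑< (m + n) f ≡ ∑< m f + ∑[ j < n ] f (m + j)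
∑-split zero    n f = refl
∑-split (suc m) n f = trans (cong (f 0 +_) (∑-split m n (f ∘ suc))) (sym (+-assoc (f 0) _ _))

∑-init-last : ∀ n (f : ℕ → ℕ) → ∑< (suc n) f ≡ ∑< n f + f n
∑-init-last zero    f = +-comm (f 0) 0
∑-init-last (suc n) f = trans (cong (f 0 +_) (∑-init-last n (f ∘ suc))) (sym (+-assoc (f 0) _ _))

delay : ℕ → (ℕ → ℕ) → ℕ → ℕ
delay zero    f i       = f i
delay (suc d) f zero    = 0
delay (suc d) f (suc i) = delay d f i

delay-< : ∀ d (f : ℕ → ℕ) {i} → i < d → delay d f i ≡ 0
delay-< (suc d) f {zero}  _         = refl
delay-< (suc d) f {suc i} (s<s i<d) = delay-< d f i<d

delay-+ : ∀ d (f : ℕ → ℕ) b → delay d f (d + b) ≡ f b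
delay-+ zero    f b = refl
delay-+ (suc d) f b = delay-+ d f b

∑-delay : ∀ d n (f : ℕ → ℕ) → ∑< n (delay d f) ≡ ∑< (n ∸ d) f
∑-delay zero    n       f = refl
∑-delay (suc d) zero    f = refl
∑-delay (suc d) (suc n) f = ∑-delay d n f

pascal-weighted : ∀ (g : ℕ → ℕ) A J r →
  (J C suc r) * g (suc (J ∸ suc r)) * A + (J C r) * g (J ∸ r) * A ≡ (suc J C suc r) * g (J ∸ r) * A
pascal-weighted g A J r = begin
    (J C suc r) * g (suc (J ∸ suc r)) * A + (J C r) * g (J ∸ r) * A
  ≡⟨ cong (λ x → x * A + (J C r) * g (J ∸ r) * A) shift ⟩
    (J C suc r) * g (J ∸ r) * A + (J C r) * g (J ∸ r) * A
  ≡⟨ sym (*-distribʳ-+ A ((J C suc r) * g (J ∸ r)) _) ⟩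
    ((J C suc r) * g (J ∸ r) + (J C r) * g (J ∸ r)) * A
  ≡⟨ cong (_* A) (sym (*-distribʳ-+ (g (J ∸ r)) (J C suc r) (J C r))) ⟩
    ((J C suc r) + (J C r)) * g (J ∸ r) * A
  ≡⟨ cong (λ c → c * g (J ∸ r) * A) (trans (+-comm (J C suc r) _) (nCk+nC[k+1]≡[n+1]C[k+1] J r)) ⟩
    (suc J C suc r) * g (J ∸ r) * A
  ∎
  where
  open ≡-Reasoning
  shift : (J C suc r) * g (suc (J ∸ suc r)) ≡ (J C suc r) * g (J ∸ r)
  shift with suc r ≤? J
  ... | yes r<J = cong (λ n → (J C suc r) * g n) (sym (+-∸-assoc 1 r<J))
  ... | no  r≮J rewrite k>n⇒nCk≡0 (≰⇒> r≮J) = refl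

countᵇ : {A : Set} → (A → Bool) → List A → ℕ
countᵇ p xs = length (filterᵇ p xs)

countᵇ-++ : {A : Set} (p : A → Bool) (xs ys : List A) → countᵇ p (xs ++ ys) ≡ countᵇ p xs + countᵇ p ys
countᵇ-++ p xs ys = trans (cong length (filter-++ (T? ∘ p) xs ys)) (length-++ (filterᵇ p xs))

countᵇ-concatMap : {A B : Set} (p : B → Bool) (f : A → List B) (xs : List A) →
                   countᵇ p (concatMap f xs) ≡ sum (map (countᵇ p ∘ f) xs)
countᵇ-concatMap p f []       = refl
countᵇ-concatMap p f (x ∷ xs) =
  trans (countᵇ-++ p (f x) (concatMap f xs)) (cong (countᵇ p (f x) +_) (countᵇ-concatMap p f xs))

countᵇ-map : {A B : Set} (p : B → Bool) (g : A → B) (xs : List A) →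
             countᵇ p (map g xs) ≡ countᵇ (p ∘ g) xs
countᵇ-map p g []       = refl
countᵇ-map p g (x ∷ xs) with p (g x)
... | true  = cong suc (countᵇ-map p g xs)
... | false = countᵇ-map p g xs

countᵇ-cong : {A : Set} {p q : A → Bool} (xs : List A) → (∀ x → p x ≡ q x) → countᵇ p xs ≡ countᵇ q xs
countᵇ-cong []           eq = refl
countᵇ-cong {p = p} {q} (x ∷ xs) eq with p x | q x | eq x
... | true  | true  | refl = cong suc (countᵇ-cong xs eq)
... | false | false | refl = countᵇ-cong xs eq

countᵇ-none : {A : Set} {p : A → Bool} (xs : List A) → (∀ x → p x ≡ false) → countᵇ p xs ≡ 0
countᵇ-none []                 none = refl
countᵇ-none {p = p} (x ∷ xs) none with p x | none x
... | false | refl = countᵇ-none xs none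

-- Occupancies of the lot

freeCount : List Bool → ℕ
freeCount []           = 0
freeCount (true ∷ bs)  = freeCount bs
freeCount (false ∷ bs) = suc (freeCount bs)

-- Spaces are indexed from 0 here; positions beyond the lot count as occupied.
occupied : List Bool → ℕ → Bool
occupied []       _       = true
occupied (b ∷ bs) zero    = b
occupied (b ∷ bs) (suc e) = occupied bs e

isLastFree : List Bool → ℕ → Bool
isLastFree []       _       = false
isLastFree (b ∷ bs) zero    = not b ∧ (freeCount bs ≡ᵇ 0)
isLastFree (b ∷ bs) (suc e) = isLastFree bs e

emptyLot : ℕ → List Bool
emptyLot m = replicate m false

freeCount-emptyLot : ∀ m → freeCount (emptyLot m) ≡ m
freeCount-emptyLot zero    = refl
freeCount-emptyLot (suc m) = cong suc (freeCount-emptyLot m)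

emptyLot-split : ∀ {e m} → e < m → emptyLot m ≡ emptyLot e ++ false ∷ emptyLot (m ∸ suc e)
emptyLot-split {zero}  {suc m} _         = refl
emptyLot-split {suc e} {suc m} (s<s e<m) = cong (false ∷_) (emptyLot-split e<m)

freeCount-∷ : ∀ b {xs ys} → freeCount xs ≡ suc (freeCount ys) →
              freeCount (b ∷ xs) ≡ suc (freeCount (b ∷ ys))
freeCount-∷ true  eq = eq
freeCount-∷ false eq = cong suc eq

freeCount-park : ∀ occ a {o} → park occ (suc a) ≡ just o → freeCount occ ≡ suc (freeCount o)
freeCount-park []           a       ()
freeCount-park (b ∷ bs)     (suc a) eq with park bs (suc a) in q
freeCount-park (b ∷ bs)     (suc a) refl | just o = freeCount-∷ b (freeCount-park bs a q)
freeCount-park (true ∷ bs)  zero    eq with park bs 1 in q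
freeCount-park (true ∷ bs)  zero    refl | just o = freeCount-park bs 0 q
freeCount-park (false ∷ bs) zero    refl = refl

length-park : ∀ occ a {o} → park occ (suc a) ≡ just o → length o ≡ length occ
length-park []           a       ()
length-park (b ∷ bs)     (suc a) eq with park bs (suc a) in q
length-park (b ∷ bs)     (suc a) refl | just o = cong suc (length-park bs a q)
length-park (true ∷ bs)  zero    eq with park bs 1 in q
length-park (true ∷ bs)  zero    refl | just o = cong suc (length-park bs 0 q)
length-park (false ∷ bs) zero    refl = refl

park-full : ∀ occ a → freeCount occ ≡ 0 → park occ (suc a) ≡ nothing
park-full []           a       _    = refl
park-full (true ∷ bs)  (suc a) full rewrite park-full bs a full = refl
park-full (true ∷ bs)  zero    full rewrite park-full bs 0 full = refl

park-beyond : ∀ occ a → length occ ≤ a → park occ (suc a) ≡ nothing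
park-beyond []       a       _         = refl
park-beyond (b ∷ bs) (suc a) (s≤s len) rewrite park-beyond bs a len = refl

occupied-park : ∀ occ a e {o} → occupied occ e ≡ true → park occ (suc a) ≡ just o →
                occupied o e ≡ true
occupied-park []           a       e       occ-e ()
occupied-park (b ∷ bs)     (suc a) e       occ-e eq with park bs (suc a) in q
occupied-park (b ∷ bs)     (suc a) zero    occ-e refl | just o = occ-e
occupied-park (b ∷ bs)     (suc a) (suc e) occ-e refl | just o = occupied-park bs a e occ-e q
occupied-park (true ∷ bs)  zero    e       occ-e eq with park bs 1 in q
occupied-park (true ∷ bs)  zero    zero    occ-e refl | just o = refl
occupied-park (true ∷ bs)  zero    (suc e) occ-e refl | just o = occupied-park bs 0 e occ-e q
occupied-park (false ∷ bs) zero    zero    occ-e refl = refl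
occupied-park (false ∷ bs) zero    (suc e) occ-e refl = occ-e

isLastFree-occupied : ∀ occ e → occupied occ e ≡ true → isLastFree occ e ≡ false
isLastFree-occupied []          e       _     = refl
isLastFree-occupied (true ∷ bs) zero    _     = refl
isLastFree-occupied (b ∷ bs)    (suc e) occ-e = isLastFree-occupied bs e occ-e

isLastFree-full : ∀ occ e → freeCount occ ≡ 0 → isLastFree occ e ≡ false
isLastFree-full []          e       _    = refl
isLastFree-full (true ∷ bs) zero    _    = refl
isLastFree-full (true ∷ bs) (suc e) full = isLastFree-full bs e full

∑-isLastFree : ∀ occ → 0 < freeCount occ →
               ∑[ e < length occ ] (if isLastFree occ e then 1 else 0) ≡ 1
∑-isLastFree (true ∷ bs)  pos = ∑-isLastFree bs pos
∑-isLastFree (false ∷ bs) _ with freeCount bs in fb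
... | zero  =
  cong suc (∑-zero (length bs) (λ e _ → cong (λ b → if b then 1 else 0) (isLastFree-full bs e fb)))
... | suc _ = ∑-isLastFree bs (subst (0 <_) (sym fb) z<s)

occupied-gap : ∀ X b W → occupied (X ++ b ∷ W) (length X) ≡ b
occupied-gap []      b W = refl
occupied-gap (x ∷ X) b W = occupied-gap X b W

isLastFree-gap : ∀ X Y → isLastFree (X ++ false ∷ Y) (length X) ≡ (freeCount Y ≡ᵇ 0)
isLastFree-gap []      Y = refl
isLastFree-gap (x ∷ X) Y = isLastFree-gap X Y

park-before-gap : ∀ X Y a → a ≤ length X →
  park (X ++ false ∷ Y) (suc a)
    ≡ maybe′ (λ X' → just (X' ++ false ∷ Y)) (just (X ++ true ∷ Y)) (park X (suc a))
park-before-gap []           Y zero    _ = refl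
park-before-gap (x ∷ X)      Y (suc a) a≤ rewrite park-before-gap X Y a (≤-pred a≤) with park X (suc a)
... | nothing = refl
... | just _  = refl
park-before-gap (true ∷ X)   Y zero    _ rewrite park-before-gap X Y 0 z≤n with park X 1
... | nothing = refl
... | just _  = refl
park-before-gap (false ∷ X)  Y zero    _ = refl

park-after-gap : ∀ X Y b →
  park (X ++ false ∷ Y) (suc (suc (length X + b))) ≡ Maybe.map (λ Y' → X ++ false ∷ Y') (park Y (suc b))
park-after-gap []      Y b = refl
park-after-gap (x ∷ X) Y b =
  trans (cong (Maybe.map (x ∷_)) (park-after-gap X Y b)) (sym (map-∘ (park Y (suc b))))

-- Counting the sequences that park

-- parkCount s occ J counts the sequences in [1,s]^J all of whose cars park when
-- started from the occupancy occ; lastFreeCount s occ e J counts those among them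
-- that leave space e as the last free space.
parkCount : ℕ → List Bool → ℕ → ℕ
parkCount s occ zero    = 1
parkCount s occ (suc J) = ∑[ i < s ] maybe′ (λ o → parkCount s o J) 0 (park occ (suc i))

lastFreeCount : ℕ → List Bool → ℕ → ℕ → ℕ
lastFreeCount s occ e zero    = if isLastFree occ e then 1 else 0
lastFreeCount s occ e (suc J) =
  ∑[ i < s ] maybe′ (λ o → if occupied o e then 0 else lastFreeCount s o e J) 0 (park occ (suc i))

lastFreeCount-occupied : ∀ s J occ e → occupied occ e ≡ true → lastFreeCount s occ e J ≡ 0
lastFreeCount-occupied s zero    occ e occ-e rewrite isLastFree-occupied occ e occ-e = refl
lastFreeCount-occupied s (suc J) occ e occ-e = ∑-zero s vanish
  where
  vanish : ∀ i → i < s →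
    maybe′ (λ o → if occupied o e then 0 else lastFreeCount s o e J) 0 (park occ (suc i)) ≡ 0
  vanish i _ with park occ (suc i) in q
  ... | nothing = refl
  ... | just o rewrite occupied-park occ i e occ-e q = refl

parkCount-∑-lastFreeCount : ∀ s J occ → J < freeCount occ →
  parkCount s occ J ≡ ∑[ e < length occ ] lastFreeCount s occ e J
parkCount-∑-lastFreeCount s zero    occ pos = sym (∑-isLastFree occ pos)
parkCount-∑-lastFreeCount s (suc J) occ J<free =
  trans (∑-cong s firstCar)
        (∑-comm s (length occ) (λ i e →
          maybe′ (λ o → if occupied o e then 0 else lastFreeCount s o e J) 0 (park occ (suc i))))
  where
  firstCar : ∀ i → maybe′ (λ o → parkCount s o J) 0 (park occ (suc i))
    ≡ ∑[ e < length occ ] maybe′ (λ o → if occupied o e then 0 else lastFreeCount s o e J) 0 (park occ (suc i))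
  firstCar i with park occ (suc i) in q
  ... | nothing = sym (∑-zero (length occ) (λ _ _ → refl))
  ... | just o  = begin
      parkCount s o J
    ≡⟨ parkCount-∑-lastFreeCount s J o (≤-pred (subst (suc (suc J) ≤_) (freeCount-park occ i q) J<free)) ⟩
      ∑[ e < length o ] lastFreeCount s o e J
    ≡⟨ cong (λ n → ∑[ e < n ] lastFreeCount s o e J) (length-park occ i q) ⟩
      ∑[ e < length occ ] lastFreeCount s o e J
    ≡⟨ ∑-cong (length occ) skipOccupied ⟩
      ∑[ e < length occ ] (if occupied o e then 0 else lastFreeCount s o e J)
    ∎
    where
    open ≡-Reasoning
    skipOccupied : ∀ e → lastFreeCount s o e J ≡ (if occupied o e then 0 else lastFreeCount s o e J)
    skipOccupied e with occupied o e in occ-e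
    ... | true  = lastFreeCount-occupied s J o e occ-e
    ... | false = refl

lastFreeCount-gap-suc : ∀ s J X Y →
  lastFreeCount s (X ++ false ∷ Y) (length X) (suc J)
    ≡ ∑[ i < s ] maybe′ (λ X' → lastFreeCount s (X' ++ false ∷ Y) (length X) J) 0 (park X (suc i))
      + ∑[ b < s ∸ suc (length X) ]
          maybe′ (λ Y' → lastFreeCount s (X ++ false ∷ Y') (length X) J) 0 (park Y (suc b))
lastFreeCount-gap-suc s J X Y =
  trans (∑-cong s firstCar)
        (trans (∑-distrib-+ s left (delay (suc e) right))
               (cong (∑< s left +_) (∑-delay (suc e) s right)))
  where
  e = length X
  left right : ℕ → ℕ
  left i  = maybe′ (λ X' → lastFreeCount s (X' ++ false ∷ Y) e J) 0 (park X (suc i))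
  right b = maybe′ (λ Y' → lastFreeCount s (X ++ false ∷ Y') e J) 0 (park Y (suc b))

  firstCar : ∀ i →
    maybe′ (λ o → if occupied o e then 0 else lastFreeCount s o e J) 0 (park (X ++ false ∷ Y) (suc i))
      ≡ left i + delay (suc e) right i
  firstCar i with i ≤? e
  ... | yes i≤e rewrite park-before-gap X Y i i≤e | delay-< (suc e) right (s≤s i≤e)
                 with park X (suc i) in q
  ...   | nothing rewrite occupied-gap X true Y = refl
  ...   | just X' rewrite trans (cong (occupied (X' ++ false ∷ Y)) (sym (length-park X i q)))
                                (occupied-gap X' false Y)
                  = sym (+-identityʳ _)
  firstCar i | no i≰e with b , refl ← m≤n⇒∃[o]m+o≡n (≰⇒> i≰e)
    rewrite park-after-gap X Y b
          | park-beyond X (suc (e + b)) (m≤n⇒m≤1+n (m≤m+n e b))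
          | delay-+ (suc e) right b
    with park Y (suc b)
  ... | nothing = refl
  ... | just Y' rewrite occupied-gap X false Y' = refl

module GapStep
  (s J : ℕ)
  (IH : ∀ X Y → lastFreeCount s (X ++ false ∷ Y) (length X) J
                ≡ (J C freeCount Y) * parkCount s X (J ∸ freeCount Y)
                  * parkCount (s ∸ suc (length X)) Y (freeCount Y))
  where

  carsBeforeGap : ∀ X Y {f} → freeCount Y ≡ f →
    ∑[ i < s ] maybe′ (λ X' → lastFreeCount s (X' ++ false ∷ Y) (length X) J) 0 (park X (suc i))
      ≡ (J C f) * parkCount s X (suc (J ∸ f)) * parkCount (s ∸ suc (length X)) Y f
  carsBeforeGap X Y {f} refl = begin
      ∑[ i < s ] maybe′ (λ X' → lastFreeCount s (X' ++ false ∷ Y) (length X) J) 0 (park X (suc i))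
    ≡⟨ ∑-cong s term ⟩
      ∑[ i < s ] (c * maybe′ (λ X' → parkCount s X' (J ∸ f)) 0 (park X (suc i)) * A)
    ≡⟨ sym (*-distribʳ-∑ s A _) ⟩
      ∑[ i < s ] (c * maybe′ (λ X' → parkCount s X' (J ∸ f)) 0 (park X (suc i))) * A
    ≡⟨ cong (_* A) (sym (*-distribˡ-∑ s c _)) ⟩
      c * parkCount s X (suc (J ∸ f)) * A
    ∎
    where
    open ≡-Reasoning
    c = J C f
    A = parkCount (s ∸ suc (length X)) Y f
    term : ∀ i → maybe′ (λ X' → lastFreeCount s (X' ++ false ∷ Y) (length X) J) 0 (park X (suc i))
                 ≡ c * maybe′ (λ X' → parkCount s X' (J ∸ f)) 0 (park X (suc i)) * A
    term i with park X (suc i) in q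
    ... | nothing = sym (cong (_* A) (*-zeroʳ c))
    ... | just X' rewrite sym (length-park X i q) = IH X' Y

  carsAfterGap-full : ∀ X Y → freeCount Y ≡ 0 →
    ∑[ b < s ∸ suc (length X) ]
      maybe′ (λ Y' → lastFreeCount s (X ++ false ∷ Y') (length X) J) 0 (park Y (suc b)) ≡ 0
  carsAfterGap-full X Y full =
    ∑-zero (s ∸ suc (length X)) (λ b _ → cong (maybe′ _ 0) (park-full Y b full))

  carsAfterGap : ∀ X Y {r} → freeCount Y ≡ suc r →
    ∑[ b < s ∸ suc (length X) ]
      maybe′ (λ Y' → lastFreeCount s (X ++ false ∷ Y') (length X) J) 0 (park Y (suc b))
      ≡ (J C r) * parkCount s X (J ∸ r) * parkCount (s ∸ suc (length X)) Y (suc r)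
  carsAfterGap X Y {r} fY = trans (∑-cong s' term) (sym (*-distribˡ-∑ s' c _))
    where
    s' = s ∸ suc (length X)
    c = (J C r) * parkCount s X (J ∸ r)
    term : ∀ b → maybe′ (λ Y' → lastFreeCount s (X ++ false ∷ Y') (length X) J) 0 (park Y (suc b))
                 ≡ c * maybe′ (λ Y' → parkCount s' Y' r) 0 (park Y (suc b))
    term b with park Y (suc b) in q
    ... | nothing = sym (*-zeroʳ c)
    ... | just Y' =
      trans (IH X Y')
            (cong (λ f → (J C f) * parkCount s X (J ∸ f) * parkCount s' Y' f)
                  (suc-injective (trans (sym (freeCount-park Y b q)) fY)))

  lastFreeCount-gap : ∀ X Y → lastFreeCount s (X ++ false ∷ Y) (length X) (suc J)
    ≡ (suc J C freeCount Y) * parkCount s X (suc J ∸ freeCount Y)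
      * parkCount (s ∸ suc (length X)) Y (freeCount Y)
  lastFreeCount-gap X Y with freeCount Y in fY
  ... | zero  = trans (lastFreeCount-gap-suc s J X Y)
                      (trans (cong₂ _+_ (carsBeforeGap X Y fY) (carsAfterGap-full X Y fY))
                             (+-identityʳ _))
  ... | suc r = trans (lastFreeCount-gap-suc s J X Y)
                      (trans (cong₂ _+_ (carsBeforeGap X Y fY) (carsAfterGap X Y fY))
                             (pascal-weighted (parkCount s X) _ J r))

lastFreeCount-split : ∀ s J X Y → lastFreeCount s (X ++ false ∷ Y) (length X) J
  ≡ (J C freeCount Y) * parkCount s X (J ∸ freeCount Y) * parkCount (s ∸ suc (length X)) Y (freeCount Y)
lastFreeCount-split s zero    X Y rewrite isLastFree-gap X Y with freeCount Y
... | zero  = refl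
... | suc _ = refl
lastFreeCount-split s (suc J) X Y = GapStep.lastFreeCount-gap s J (lastFreeCount-split s J) X Y

lastFreeTerm : ℕ → ℕ → ℕ → ℕ
lastFreeTerm m N e =
  (N C (m ∸ suc e)) * parkCount m (emptyLot e) (N ∸ (m ∸ suc e))
  * parkCount (m ∸ suc e) (emptyLot (m ∸ suc e)) (m ∸ suc e)

lastFreeCount-emptyLot : ∀ m e N → e < m → lastFreeCount m (emptyLot m) e N ≡ lastFreeTerm m N e
lastFreeCount-emptyLot m e N e<m = begin
    lastFreeCount m (emptyLot m) e N
  ≡⟨ cong (λ occ → lastFreeCount m occ e N) (emptyLot-split e<m) ⟩
    lastFreeCount m (emptyLot e ++ false ∷ emptyLot r) e N
  ≡⟨ cong (λ e' → lastFreeCount m (emptyLot e ++ false ∷ emptyLot r) e' N) (sym (length-replicate e)) ⟩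
    lastFreeCount m (emptyLot e ++ false ∷ emptyLot r) (length (emptyLot e)) N
  ≡⟨ lastFreeCount-split m N (emptyLot e) (emptyLot r) ⟩
    (N C freeCount (emptyLot r)) * parkCount m (emptyLot e) (N ∸ freeCount (emptyLot r))
      * parkCount (m ∸ suc (length (emptyLot e))) (emptyLot r) (freeCount (emptyLot r))
  ≡⟨ cong₂ (λ f l → (N C f) * parkCount m (emptyLot e) (N ∸ f) * parkCount (m ∸ suc l) (emptyLot r) f)
           (freeCount-emptyLot r) (length-replicate e) ⟩
    (N C r) * parkCount m (emptyLot e) (N ∸ r) * parkCount r (emptyLot r) r
  ∎
  where
  open ≡-Reasoning
  r = m ∸ suc e

-- Filling the first free space

data FirstFreeFilled : List Bool → List Bool → Set where
  here  : ∀ {X} → FirstFreeFilled (false ∷ X) (true ∷ X)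
  there : ∀ {A B} → FirstFreeFilled A B → FirstFreeFilled (true ∷ A) (true ∷ B)

freeCount-firstFreeFilled : ∀ {A B} → FirstFreeFilled A B → freeCount A ≡ suc (freeCount B)
freeCount-firstFreeFilled here         = refl
freeCount-firstFreeFilled (there fill) = freeCount-firstFreeFilled fill

ParkAtFirstFree : List Bool → Maybe (List Bool) → Set
ParkAtFirstFree X nothing   = freeCount X ≡ 0
ParkAtFirstFree X (just X') = FirstFreeFilled X X'

park-1 : ∀ X → ParkAtFirstFree X (park X 1)
park-1 []          = refl
park-1 (true ∷ X) with park X 1 | park-1 X
... | nothing | full = full
... | just _  | fill = there fill
park-1 (false ∷ X) = here

-- One more car parking in A and in B, where B is A with its first free space
-- filled: the results stay so related, unless B is full and the car finds room
-- in A only.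
data ParkCoupling (B : List Bool) : Maybe (List Bool) → Maybe (List Bool) → Set where
  both-fail  : ParkCoupling B nothing nothing
  both-park  : ∀ {A' B'} → FirstFreeFilled A' B' → freeCount B ≡ suc (freeCount B') →
               ParkCoupling B (just A') (just B')
  first-only : ∀ {A'} → freeCount B ≡ 0 → ParkCoupling B (just A') nothing

true∷-coupling : ∀ {B r₁ r₂} → ParkCoupling B r₁ r₂ →
  ParkCoupling (true ∷ B) (Maybe.map (true ∷_) r₁) (Maybe.map (true ∷_) r₂)
true∷-coupling both-fail            = both-fail
true∷-coupling (both-park fill fr)  = both-park (there fill) fr
true∷-coupling (first-only full)    = first-only full

park-coupling : ∀ {A B} → FirstFreeFilled A B → ∀ a → ParkCoupling B (park A (suc a)) (park B (suc a))
park-coupling (here {X}) (suc a) with park X (suc a) in q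
... | nothing = both-fail
... | just _  = both-park here (freeCount-park X a q)
park-coupling (here {X}) zero with park X 1 | park-1 X
... | nothing | full = first-only full
... | just _  | fill = both-park (there fill) (freeCount-firstFreeFilled fill)
park-coupling (there fill) (suc a) = true∷-coupling (park-coupling fill a)
park-coupling (there fill) zero    = true∷-coupling (park-coupling fill zero)

parkCount-firstFreeFilled : ∀ s J {A B} → FirstFreeFilled A B → J ≤ freeCount B →
                            parkCount s A J ≡ parkCount s B J
parkCount-firstFreeFilled s zero    fill _ = refl
parkCount-firstFreeFilled s (suc J) {A} {B} fill J<free =
  ∑-cong s (λ i → afterFirstCar (park-coupling fill i))
  where
  afterFirstCar : ∀ {r₁ r₂} → ParkCoupling B r₁ r₂ →
                  maybe′ (λ o → parkCount s o J) 0 r₁ ≡ maybe′ (λ o → parkCount s o J) 0 r₂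
  afterFirstCar both-fail          = refl
  afterFirstCar (both-park fill fr) =
    parkCount-firstFreeFilled s J fill (≤-pred (subst (suc J ≤_) fr J<free))
  afterFirstCar (first-only full) with subst (suc J ≤_) full J<free
  ... | ()

parkCount-suc-bound : ∀ s J occ → length occ ≤ s → parkCount (suc s) occ J ≡ parkCount s occ J
parkCount-suc-bound s zero    occ _   = refl
parkCount-suc-bound s (suc J) occ len =
  trans (∑-init-last s (λ i → maybe′ (λ o → parkCount (suc s) o J) 0 (park occ (suc i))))
        (trans (cong₂ _+_ (∑-cong s afterFirstCar)
                          (cong (maybe′ (λ o → parkCount (suc s) o J) 0) (park-beyond occ s len)))
               (+-identityʳ _))
  where
  afterFirstCar : ∀ i → maybe′ (λ o → parkCount (suc s) o J) 0 (park occ (suc i))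
                        ≡ maybe′ (λ o → parkCount s o J) 0 (park occ (suc i))
  afterFirstCar i with park occ (suc i) in q
  ... | nothing = refl
  ... | just o  = parkCount-suc-bound s J o (subst (_≤ s) (sym (length-park occ i q)) len)

parkCount-bound : ∀ {s s'} J occ → length occ ≤ s → s ≤′ s' → parkCount s' occ J ≡ parkCount s occ J
parkCount-bound J occ len ≤′-refl          = refl
parkCount-bound J occ len (≤′-step s≤′s') =
  trans (parkCount-suc-bound _ J occ (≤-trans len (≤′⇒≤ s≤′s'))) (parkCount-bound J occ len s≤′s')

-- Relation to the preference-set counts

countᵇ-prefs-suc : ∀ (p : List ℕ → Bool) J s →
  countᵇ p (prefs (suc J) s) ≡ ∑[ i < s ] countᵇ (λ as → p (suc i ∷ as)) (prefs J s)
countᵇ-prefs-suc p J s = begin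
    countᵇ p (prefs (suc J) s)
  ≡⟨ countᵇ-concatMap p (λ a → map (a ∷_) (prefs J s)) (map suc (upTo s)) ⟩
    sum (map g (map suc (upTo s)))
  ≡⟨ cong sum (sym (List-map-∘ (upTo s))) ⟩
    sum (map (g ∘ suc) (upTo s))
  ≡⟨ sum-map-upTo s (g ∘ suc) ⟩
    ∑[ i < s ] countᵇ p (map (suc i ∷_) (prefs J s))
  ≡⟨ ∑-cong s (λ i → countᵇ-map p (suc i ∷_) (prefs J s)) ⟩
    ∑[ i < s ] countᵇ (λ as → p (suc i ∷ as)) (prefs J s)
  ∎
  where
  open ≡-Reasoning
  g : ℕ → ℕ
  g a = countᵇ p (map (a ∷_) (prefs J s))

parks? : List Bool → List ℕ → Bool
parks? occ as = does (flawsFrom occ as ≟ 0)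

parks?-∷ : ∀ occ a as → parks? occ (a ∷ as) ≡ maybe′ (λ o → parks? o as) false (park occ a)
parks?-∷ occ a as with park occ a
... | nothing = refl
... | just o  = refl

parkCount-correct : ∀ s J occ → countᵇ (parks? occ) (prefs J s) ≡ parkCount s occ J
parkCount-correct s zero    occ = refl
parkCount-correct s (suc J) occ =
  trans (countᵇ-prefs-suc (parks? occ) J s) (∑-cong s firstCar)
  where
  afterPark : ∀ r → countᵇ (λ as → maybe′ (λ o → parks? o as) false r) (prefs J s)
                    ≡ maybe′ (λ o → parkCount s o J) 0 r
  afterPark nothing  = countᵇ-none (prefs J s) (λ _ → refl)
  afterPark (just o) = parkCount-correct s J o

  firstCar : ∀ i → countᵇ (λ as → parks? occ (suc i ∷ as)) (prefs J s)
                   ≡ maybe′ (λ o → parkCount s o J) 0 (park occ (suc i))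
  firstCar i = trans (countᵇ-cong (prefs J s) (parks?-∷ occ (suc i))) (afterPark (park occ (suc i)))

pCountFirst-1-parkCount : ∀ J m →
  pCountFirst 1 (suc J) (suc m) (suc m) 0 ≡ parkCount (suc m) (true ∷ emptyLot m) J
pCountFirst-1-parkCount J m =
  trans (countᵇ-prefs-suc (λ as → headIs 1 as ∧ parks? (emptyLot (suc m)) as) J (suc m))
        (trans (cong₂ _+_ (parkCount-correct (suc m) J (true ∷ emptyLot m))
                          (∑-zero m (λ _ _ → countᵇ-none (prefs J (suc m)) (λ _ → refl))))
               (+-identityʳ _))

pCountFirst-1-emptyLot : ∀ J M → J < M → pCountFirst 1 (suc J) M M 0 ≡ parkCount M (emptyLot M) J
pCountFirst-1-emptyLot J (suc m) (s<s J≤m) =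
  trans (pCountFirst-1-parkCount J m)
        (sym (parkCount-firstFreeFilled (suc m) J here (subst (J ≤_) (sym (freeCount-emptyLot m)) J≤m)))

parkCount-emptyLot≡pCountFirst : ∀ J L s → J < L → L ≤ s →
  parkCount s (emptyLot L) J ≡ pCountFirst 1 (suc J) L L 0
parkCount-emptyLot≡pCountFirst J L s J<L L≤s =
  trans (parkCount-bound J (emptyLot L) (subst (_≤ L) (sym (length-replicate L)) ≤-refl) (≤⇒≤′ L≤s))
        (sym (pCountFirst-1-emptyLot J L J<L))

pCountFirst-1≡pCount : (k n : ℕ) → 1 ≤ n →
  pCountFirst 1 n (n + k) (n + k) 0 ≡ pCount (n ∸ 1) (n + k) (n + k) 0
pCountFirst-1≡pCount k (suc N) _ =
  trans (pCountFirst-1-emptyLot N (suc N + k) (s<s (m≤m+n N k)))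
        (sym (parkCount-correct (suc N + k) N (emptyLot (suc N + k))))

lastFreeTerm-early : ∀ N k e → e < k → lastFreeTerm (suc N + k) N e ≡ 0
lastFreeTerm-early N k e e<k
  rewrite k>n⇒nCk≡0 {N} {N + k ∸ e}
            (subst (N <_) (sym (+-∸-assoc N (<⇒≤ e<k))) (m<m+n N (m<n⇒0<n∸m e<k)))
  = refl

lastFreeTerm-late : ∀ N k j → 0 < k → j ≤ N →
  lastFreeTerm (suc N + k) N (k + j) ≡ (N C j) * pCountFirst 1 (suc j) (j + k) (j + k) 0 * pf (N ∸ j)
lastFreeTerm-late N k j 0<k j≤N = begin
    lastFreeTerm m N (k + j)
  ≡⟨ cong (λ r → (N C r) * parkCount m (emptyLot (k + j)) (N ∸ r) * parkCount r (emptyLot r) r)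
          (trans (cong (_∸ (k + j)) (+-comm N k)) ([m+n]∸[m+o]≡n∸o k N j)) ⟩
    (N C (N ∸ j)) * parkCount m (emptyLot (k + j)) (N ∸ (N ∸ j))
      * parkCount (N ∸ j) (emptyLot (N ∸ j)) (N ∸ j)
  ≡⟨ cong₂ _*_ (cong₂ _*_ (sym (nCk≡nC[n∸k] j≤N)) beforeGap) (sym (parkCount-correct (N ∸ j) (N ∸ j) _)) ⟩
    (N C j) * pCountFirst 1 (suc j) (j + k) (j + k) 0 * pf (N ∸ j)
  ∎
  where
  open ≡-Reasoning
  m = suc N + k
  beforeGap : parkCount m (emptyLot (k + j)) (N ∸ (N ∸ j)) ≡ pCountFirst 1 (suc j) (j + k) (j + k) 0
  beforeGap = begin
      parkCount m (emptyLot (k + j)) (N ∸ (N ∸ j))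
    ≡⟨ cong₂ (λ L J → parkCount m (emptyLot L) J) (+-comm k j) (m∸[m∸n]≡n j≤N) ⟩
      parkCount m (emptyLot (j + k)) j
    ≡⟨ parkCount-emptyLot≡pCountFirst j (j + k) m (m<m+n j 0<k) (+-monoˡ-≤ k (m≤n⇒m≤1+n j≤N)) ⟩
      pCountFirst 1 (suc j) (j + k) (j + k) 0
    ∎

pCountFirst-1-recurrence : (k n : ℕ) → 1 ≤ k → 1 ≤ n →
  pCountFirst 1 n (n + k) (n + k) 0
    ≡ sum (map (λ j → ((n ∸ 1) C j)
                      * pCountFirst 1 (suc j) (suc j + k ∸ 1) (suc j + k ∸ 1) 0
                      * pf (n ∸ suc j))
               (upTo n))
pCountFirst-1-recurrence k (suc N) 0<k _ = begin
    pCountFirst 1 (suc N) m m 0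
  ≡⟨ pCountFirst-1-emptyLot N m N<m ⟩
    parkCount m (emptyLot m) N
  ≡⟨ parkCount-∑-lastFreeCount m N (emptyLot m) (subst (N <_) (sym (freeCount-emptyLot m)) N<m) ⟩
    ∑[ e < length (emptyLot m) ] lastFreeCount m (emptyLot m) e N
  ≡⟨ cong (λ n → ∑[ e < n ] lastFreeCount m (emptyLot m) e N) (trans (length-replicate m) (+-comm (suc N) k)) ⟩
    ∑[ e < k + suc N ] lastFreeCount m (emptyLot m) e N
  ≡⟨ ∑-cong< (k + suc N) (λ e e<m → lastFreeCount-emptyLot m e N (subst (e <_) (+-comm k (suc N)) e<m)) ⟩
    ∑< (k + suc N) (lastFreeTerm m N)
  ≡⟨ ∑-split k (suc N) (lastFreeTerm m N) ⟩
    ∑< k (lastFreeTerm m N) + ∑[ j < suc N ] lastFreeTerm m N (k + j)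
  ≡⟨ cong₂ _+_ (∑-zero k (lastFreeTerm-early N k))
               (∑-cong< (suc N) (λ j j<n → lastFreeTerm-late N k j 0<k (≤-pred j<n))) ⟩
    ∑[ j < suc N ] ((N C j) * pCountFirst 1 (suc j) (j + k) (j + k) 0 * pf (N ∸ j))
  ≡⟨ sym (sum-map-upTo (suc N) _) ⟩
    sum (map (λ j → (N C j) * pCountFirst 1 (suc j) (j + k) (j + k) 0 * pf (N ∸ j)) (upTo (suc N)))
  ∎
  where
  open ≡-Reasoning
  m = suc N + k
  N<m : N < m
  N<m = s<s (m≤m+n N k)

theorem4p2 : ((k n : ℕ) → 1 ≤ n →
    pCountFirst 1 n (n + k) (n + k) 0 ≡ pCount (n ∸ 1) (n + k) (n + k) 0)
    ×
    ((k n : ℕ) → 1 ≤ k → 1 ≤ n →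
    pCountFirst 1 n (n + k) (n + k) 0
    ≡ sum (map (λ j → ((n ∸ 1) C j)
    * pCountFirst 1 (suc j) (suc j + k ∸ 1) (suc j + k ∸ 1) 0
    * pf (n ∸ suc j))
    (upTo n)))
theorem4p2 = pCountFirst-1≡pCount , pCountFirst-1-recurrence
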